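{- Let $n$ be a positive integer and let $G$ be a divisible design graph with parameters $(4n,3n-2,3n-6,2n-2,4,n)$ whose canonical partition $V_1,V_2,V_3,V_4$ has quotient matrix $$\begin{pmatrix} n-1&1&n-1&n-1\\ 1&n-1&n-1&n-1\\ n-1&n-1&1&n-1\\ n-1&n-1&n-1&1\end{pmatrix}.$$ Let $G'$ be the graph obtained from $G$ by complementing all adjacencies between a vertex of $V_1\cup V_2$ and a vertex of $V_3\cup V_4$ (other adjacencies unchanged). Then $G'$ is a divisible design graph with parameters $(4n,n+2,n-2,2,4,n)$ (with canonical partition $V_1,\dots,V_4$) whose quotient matrix, after renumbering the classes, is $$\begin{pmatrix} 1&n-1&1&1\\ n-1&1&1&1\\ 1&1&n-1&1\\ 1&1&1&n-1\end{pmatrix}.$$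
   Context: A divisible design graph (DDG) with parameters $(v,k,\lambda_1,\lambda_2,m,n)$ is a $k$-regular graph on $v=mn$ vertices whose vertex set can be partitioned into $m$ classes of size $n$ (a canonical partition) such that any two distinct vertices in the same class have exactly $\lambda_1$ common neighbours and any two vertices in different classes have exactly $\lambda_2$ common neighbours. The quotient matrix $(r_{ij})$ means every vertex of $V_i$ has exactly $r_{ij}$ neighbours in $V_j$. -}

module Defs where

open import Data.Nat using (ℕ; zero; suc; _∸_; _*_)
open import Data.Bool using (Bool; true; false; not; if_then_else_; _xor_)
open import Data.Fin using (Fin; zero; suc)
open import Data.Product using (_×_; _,_; proj₁)
open import Data.List using (List; length; allFin; cartesianProduct; filterᵇ)
open import Relation.Binary.PropositionalEquality using (_≡_)
open import Relation.Nullary using (¬_)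

-- Vertex set of a graph on m·n vertices equipped with a partition into
-- m classes of size n: vertex (i , a) is the a-th vertex of class V_i.
Vtx : ℕ → ℕ → Set
Vtx m n = Fin m × Fin n

cls : ∀ {m n} → Vtx m n → Fin m
cls = proj₁

allVtx : ∀ m n → List (Vtx m n)
allVtx m n = cartesianProduct (allFin m) (allFin n)

record IsSimpleGraph {V : Set} (A : V → V → Bool) : Set where
  field
    symm   : ∀ x y → A x y ≡ A y x
    irrefl : ∀ x → A x x ≡ false

deg : ∀ {m n} → (Vtx m n → Vtx m n → Bool) → Vtx m n → ℕ
deg {m} {n} A x = length (filterᵇ (A x) (allVtx m n))

common : ∀ {m n} → (Vtx m n → Vtx m n → Bool) → Vtx m n → Vtx m n → ℕ
common {m} {n} A x y =
  length (filterᵇ (λ z → if A x z then A y z else false) (allVtx m n))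

degIn : ∀ {m n} → (Vtx m n → Vtx m n → Bool) → Vtx m n → Fin m → ℕ
degIn {m} {n} A x j = length (filterᵇ (λ a → A x (j , a)) (allFin n))

-- G is a divisible design graph with parameters (m·n, k, λ₁, λ₂, m, n)
-- with canonical partition given by cls (classes V_i = {(i , a)}).
record IsDDG (m n k λ₁ λ₂ : ℕ) (A : Vtx m n → Vtx m n → Bool) : Set where
  field
    simple   : IsSimpleGraph A
    regular  : ∀ x → deg A x ≡ k
    sameCls  : ∀ x y → ¬ x ≡ y → cls x ≡ cls y → common A x y ≡ λ₁
    diffCls  : ∀ x y → ¬ cls x ≡ cls y → common A x y ≡ λ₂

HasQuotient : ∀ {m n} → (Vtx m n → Vtx m n → Bool) → (Fin m → Fin m → ℕ) → Set
HasQuotient {m} {n} A r = ∀ (i j : Fin m) (a : Fin n) → degIn A (i , a) j ≡ r i j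

-- The quotient matrix in the hypothesis (classes V_1..V_4 = Fin 4 indices 0..3).
Qhyp : ℕ → Fin 4 → Fin 4 → ℕ
Qhyp n zero zero = n ∸ 1
Qhyp n zero (suc zero) = 1
Qhyp n (suc zero) zero = 1
Qhyp n (suc zero) (suc zero) = n ∸ 1
Qhyp n (suc (suc zero)) (suc (suc zero)) = 1
Qhyp n (suc (suc (suc zero))) (suc (suc (suc zero))) = 1
Qhyp n _ _ = n ∸ 1

Qconc : ℕ → Fin 4 → Fin 4 → ℕ
Qconc n zero (suc zero) = n ∸ 1
Qconc n (suc zero) zero = n ∸ 1
Qconc n (suc (suc zero)) (suc (suc zero)) = n ∸ 1
Qconc n (suc (suc (suc zero))) (suc (suc (suc zero))) = n ∸ 1
Qconc n _ _ = 1

side : Fin 4 → Bool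
side zero = false
side (suc zero) = false
side _ = true

switch : ∀ {n} → (Vtx 4 n → Vtx 4 n → Bool) → Vtx 4 n → Vtx 4 n → Bool
switch A x y = if side (cls x) xor side (cls y) then not (A x y) else A x y

{-# OPTIONS --safe #-}
-- Split every count along the four classes and call V₁ ∪ V₂ and V₃ ∪ V₄ the two halves.
-- Within one class V_j the switch keeps the rows of x and y towards V_j, complements one
-- of them, or complements both; by inclusion–exclusion the number λ_j of common neighbours
-- in V_j becomes λ_j, r − λ_j (r the degree into V_j of the unchanged vertex), or
-- n − r_x − r_y + λ_j.  The quotient matrix gives every vertex n − 1 neighbours in each
-- class of the other half, hence, by (3n − 2)-regularity, n neighbours in its own half.
-- Summing over the classes, a pair in one half loses 2(n − 2) common neighbours, while
-- for a pair in opposite halves the old and new counts add up to 2n.  Degrees and the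
-- quotient matrix are read off the same way; the renumbering exchanges the halves.
module Submission where

open import Defs
open import Data.Nat using (ℕ; zero; suc; _∸_; _*_; _+_; _≥_; _≤_; s≤s; z≤n)
open import Data.Nat.Properties using (+-suc; +-comm; +-identityʳ; +-cancelʳ-≡; m+n∸m≡n)
open import Data.Nat.ListAction using (sum)
open import Data.Nat.Tactic.RingSolver using (solve-∀)
open import Data.Bool using (Bool; true; false; not; _∧_; if_then_else_; _xor_)
open import Data.Bool.Properties
  using (∧-comm; xor-comm; xor-same; not-¬; ¬-not; not-distribˡ-xor) renaming (_≟_ to _≟ᵇ_)
open import Data.Fin using (Fin; zero; suc)
open import Function using (id; _∘_)
open import Data.List using (List; []; _∷_; _++_; map; length; filterᵇ; allFin; cartesianProduct)
open import Data.List.Properties using (length-tabulate; map-cong)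
open import Data.Product using (_×_; _,_; Σ)
open import Data.Empty using (⊥-elim)
open import Data.Fin.Permutation using (Permutation′; _⟨$⟩ʳ_; permutation)
open import Relation.Nullary using (¬_; yes; no; contradiction)
open import Relation.Binary.PropositionalEquality

private variable X Y : Set

count : (X → Bool) → List X → ℕ
count p xs = length (filterᵇ p xs)

count-cong : ∀ {p q : X → Bool} xs → (∀ x → p x ≡ q x) → count p xs ≡ count q xs
count-cong [] _ = refl
count-cong {p = p} {q = q} (x ∷ xs) p≗q with p x | q x | p≗q x
... | true  | .true  | refl = cong suc (count-cong xs p≗q)
... | false | .false | refl = count-cong xs p≗q

count-++ : ∀ (p : X → Bool) xs ys → count p (xs ++ ys) ≡ count p xs + count p ys
count-++ p [] ys = refl
count-++ p (x ∷ xs) ys with p x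
... | true  = cong suc (count-++ p xs ys)
... | false = count-++ p xs ys

count-map : ∀ (p : Y → Bool) (f : X → Y) xs → count p (map f xs) ≡ count (λ x → p (f x)) xs
count-map p f [] = refl
count-map p f (x ∷ xs) with p (f x)
... | true  = cong suc (count-map p f xs)
... | false = count-map p f xs

count-not : ∀ (f : X → Bool) xs → count (λ x → not (f x)) xs + count f xs ≡ length xs
count-not f [] = refl
count-not f (x ∷ xs) with f x
... | true  = trans (+-suc _ _) (cong suc (count-not f xs))
... | false = cong suc (count-not f xs)

count-∧-not : ∀ (f g : X → Bool) xs →
  count (λ x → f x ∧ not (g x)) xs + count (λ x → f x ∧ g x) xs ≡ count f xs
count-∧-not f g [] = refl
count-∧-not f g (x ∷ xs) with f x | g x
... | true  | true  = trans (+-suc _ _) (cong suc (count-∧-not f g xs))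
... | true  | false = cong suc (count-∧-not f g xs)
... | false | _     = count-∧-not f g xs

count-not-∧-not : ∀ (f g : X → Bool) xs →
  count (λ x → not (f x) ∧ not (g x)) xs + count f xs + count g xs
    ≡ length xs + count (λ x → f x ∧ g x) xs
count-not-∧-not f g xs = begin
  a + F + G                           ≡⟨ cong (a + F +_) G≡b+c ⟩
  a + F + (b + c)                     ≡⟨ rearrange a F b c ⟩
  (a + b) + F + c                     ≡⟨ cong (λ t → t + F + c) (count-∧-not (λ x → not (f x)) g xs) ⟩
  count (λ x → not (f x)) xs + F + c  ≡⟨ cong (_+ c) (count-not f xs) ⟩
  length xs + c                       ∎
  where
  open ≡-Reasoning
  a = count (λ x → not (f x) ∧ not (g x)) xs
  b = count (λ x → not (f x) ∧ g x) xs
  c = count (λ x → f x ∧ g x) xs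
  F = count f xs
  G = count g xs
  G≡b+c : G ≡ b + c
  G≡b+c = begin
    G
      ≡⟨ count-∧-not g f xs ⟨
    count (λ x → g x ∧ not (f x)) xs + count (λ x → g x ∧ f x) xs
      ≡⟨ cong₂ _+_ (count-cong xs (λ x → ∧-comm (g x) (not (f x))))
                   (count-cong xs (λ x → ∧-comm (g x) (f x))) ⟩
    b + c ∎
  rearrange : ∀ a F b c → a + F + (b + c) ≡ (a + b) + F + c
  rearrange = solve-∀

count-cartesianProduct : ∀ (p : X × Y → Bool) xs ys →
  count p (cartesianProduct xs ys) ≡ sum (map (λ x → count (λ y → p (x , y)) ys) xs)
count-cartesianProduct p [] ys = refl
count-cartesianProduct p (x ∷ xs) ys =
  trans (count-++ p (map (x ,_) ys) _)
        (cong₂ _+_ (count-map p (x ,_) ys) (count-cartesianProduct p xs ys))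

sum-map-+ : ∀ (f g : X → ℕ) xs → sum (map (λ x → f x + g x) xs) ≡ sum (map f xs) + sum (map g xs)
sum-map-+ f g [] = refl
sum-map-+ f g (x ∷ xs) = trans (cong (f x + g x +_) (sum-map-+ f g xs)) (interchange (f x) (g x) _ _)
  where
  interchange : ∀ a b c d → a + b + (c + d) ≡ a + c + (b + d)
  interchange = solve-∀

-- Opaque so that equations between class sums are unified without unfolding them.
opaque
  classSum : ∀ {m} → (Fin m → ℕ) → ℕ
  classSum {m} h = sum (map h (allFin m))

  classSum-+ : ∀ {m} (f g : Fin m → ℕ) → classSum (λ j → f j + g j) ≡ classSum f + classSum g
  classSum-+ {m} f g = sum-map-+ f g (allFin m)

  classSum-cong : ∀ {m} {f g : Fin m → ℕ} → (∀ j → f j ≡ g j) → classSum f ≡ classSum g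
  classSum-cong {m} f≗g = cong sum (map-cong f≗g (allFin m))

classSum-+-cong : ∀ {m} {f g h : Fin m → ℕ} → (∀ j → f j + g j ≡ h j) →
  classSum f + classSum g ≡ classSum h
classSum-+-cong {f = f} {g} f+g≗h = trans (sym (classSum-+ f g)) (classSum-cong f+g≗h)

commonIn : ∀ {m n} → (Vtx m n → Vtx m n → Bool) → Vtx m n → Vtx m n → Fin m → ℕ
commonIn {n = n} A x y j = count (λ a → A x (j , a) ∧ A y (j , a)) (allFin n)

opaque
  unfolding classSum

  deg-classSum : ∀ {m n} (A : Vtx m n → Vtx m n → Bool) x → deg A x ≡ classSum (degIn A x)
  deg-classSum {m} {n} A x = count-cartesianProduct (A x) (allFin m) (allFin n)

  common-classSum : ∀ {m n} (A : Vtx m n → Vtx m n → Bool) x y →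
    common A x y ≡ classSum (commonIn A x y)
  common-classSum {m} {n} A x y =
    trans (count-cong (allVtx m n) (λ z → if-then-false (A x z)))
          (count-cartesianProduct (λ z → A x z ∧ A y z) (allFin m) (allFin n))
    where
    if-then-false : ∀ a {b} → (if a then b else false) ≡ a ∧ b
    if-then-false true  = refl
    if-then-false false = refl

  classSum-crossing : ∀ s k → classSum (λ j → if s xor side j then k else 0) ≡ k + k
  classSum-crossing false k = cong (k +_) (+-identityʳ k)
  classSum-crossing true  k = cong (k +_) (+-identityʳ k)

crosses : ∀ {n} → Vtx 4 n → Fin 4 → Bool
crosses x j = side (cls x) xor side j

module _ {n} (A : Vtx 4 n → Vtx 4 n → Bool) where

  switch-xor : ∀ x y → switch A x y ≡ (side (cls x) xor side (cls y)) xor A x y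
  switch-xor x y with side (cls x) xor side (cls y)
  ... | true  = refl
  ... | false = refl

  switch-isSimpleGraph : IsSimpleGraph A → IsSimpleGraph (switch A)
  switch-isSimpleGraph simple = record
    { symm   = λ x y → trans (switch-xor x y)
                 (trans (cong₂ _xor_ (xor-comm (side (cls x)) (side (cls y))) (symm x y))
                        (sym (switch-xor y x)))
    ; irrefl = λ x → trans (switch-xor x x) (cong₂ _xor_ (xor-same (side (cls x))) (irrefl x))
    }
    where open IsSimpleGraph simple

  degInOwnHalf : Vtx 4 n → ℕ
  degInOwnHalf x = classSum (λ j → if crosses x j then 0 else degIn A x j)

  module _ (x : Vtx 4 n) (j : Fin 4) where

    degIn-switch : ∀ {s} → crosses x j ≡ s →
      degIn (switch A) x j ≡ count (λ a → s xor A x (j , a)) (allFin n)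
    degIn-switch refl = count-cong (allFin n) (λ a → switch-xor x (j , a))

    degIn-switch-uncrossed : crosses x j ≡ false → degIn (switch A) x j ≡ degIn A x j
    degIn-switch-uncrossed = degIn-switch

    degIn-switch-crossed : crosses x j ≡ true → degIn (switch A) x j + degIn A x j ≡ n
    degIn-switch-crossed x↔j =
      trans (cong (_+ degIn A x j) (degIn-switch x↔j))
            (trans (count-not (λ a → A x (j , a)) (allFin n)) (length-tabulate id))

  module _ (x y : Vtx 4 n) (j : Fin 4) where

    private
      f g : Fin n → Bool
      f a = A x (j , a)
      g a = A y (j , a)

    commonIn-switch : ∀ {s t} → crosses x j ≡ s → crosses y j ≡ t →
      commonIn (switch A) x y j ≡ count (λ a → (s xor f a) ∧ (t xor g a)) (allFin n)
    commonIn-switch refl refl =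
      count-cong (allFin n) (λ a → cong₂ _∧_ (switch-xor x (j , a)) (switch-xor y (j , a)))

    commonIn-switch-neither : crosses x j ≡ false → crosses y j ≡ false →
      commonIn (switch A) x y j ≡ commonIn A x y j
    commonIn-switch-neither = commonIn-switch

    commonIn-switch-both : crosses x j ≡ true → crosses y j ≡ true →
      commonIn (switch A) x y j + degIn A x j + degIn A y j ≡ n + commonIn A x y j
    commonIn-switch-both x↔j y↔j =
      trans (cong (λ c → c + degIn A x j + degIn A y j) (commonIn-switch x↔j y↔j))
            (trans (count-not-∧-not f g (allFin n)) (cong (_+ commonIn A x y j) (length-tabulate id)))

    commonIn-switch-second : crosses x j ≡ false → crosses y j ≡ true →
      commonIn (switch A) x y j + commonIn A x y j ≡ degIn A x j
    commonIn-switch-second x↔j y↔j =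
      trans (cong (_+ commonIn A x y j) (commonIn-switch x↔j y↔j)) (count-∧-not f g (allFin n))

    commonIn-switch-first : crosses x j ≡ true → crosses y j ≡ false →
      commonIn (switch A) x y j + commonIn A x y j ≡ degIn A y j
    commonIn-switch-first x↔j y↔j =
      trans (cong₂ _+_ (trans (commonIn-switch x↔j y↔j)
                              (count-cong (allFin n) (λ a → ∧-comm (not (f a)) (g a))))
                       (count-cong (allFin n) (λ a → ∧-comm (f a) (g a))))
            (count-∧-not g f (allFin n))

Qhyp-across : ∀ n i j → side i xor side j ≡ true → Qhyp n i j ≡ n ∸ 1
Qhyp-across n zero                   (suc (suc j)) _ = refl
Qhyp-across n (suc zero)             (suc (suc j)) _ = refl
Qhyp-across n (suc (suc zero))       zero          _ = refl
Qhyp-across n (suc (suc zero))       (suc zero)    _ = refl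
Qhyp-across n (suc (suc (suc zero))) zero          _ = refl
Qhyp-across n (suc (suc (suc zero))) (suc zero)    _ = refl
Qhyp-across n zero                   zero          ()
Qhyp-across n zero                   (suc zero)    ()
Qhyp-across n (suc zero)             zero          ()
Qhyp-across n (suc zero)             (suc zero)    ()
Qhyp-across n (suc (suc i))          (suc (suc j)) ()

swapHalves : Fin 4 → Fin 4
swapHalves zero                   = suc (suc zero)
swapHalves (suc zero)             = suc (suc (suc zero))
swapHalves (suc (suc zero))       = zero
swapHalves (suc (suc (suc zero))) = suc zero

swapHalves-involutive : ∀ i → swapHalves (swapHalves i) ≡ i
swapHalves-involutive zero                   = refl
swapHalves-involutive (suc zero)             = refl
swapHalves-involutive (suc (suc zero))       = refl
swapHalves-involutive (suc (suc (suc zero))) = refl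

swapHalvesᵖ : Permutation′ 4
swapHalvesᵖ = permutation swapHalves swapHalves swapHalves-involutive swapHalves-involutive

Qconc-swapHalves : ∀ n i j →
  Qconc n (swapHalves i) (swapHalves j) ≡ (if side i xor side j then 1 else Qhyp n i j)
Qconc-swapHalves n zero                   zero                   = refl
Qconc-swapHalves n zero                   (suc zero)             = refl
Qconc-swapHalves n zero                   (suc (suc zero))       = refl
Qconc-swapHalves n zero                   (suc (suc (suc zero))) = refl
Qconc-swapHalves n (suc zero)             zero                   = refl
Qconc-swapHalves n (suc zero)             (suc zero)             = refl
Qconc-swapHalves n (suc zero)             (suc (suc zero))       = refl
Qconc-swapHalves n (suc zero)             (suc (suc (suc zero))) = refl
Qconc-swapHalves n (suc (suc zero))       zero                   = refl
Qconc-swapHalves n (suc (suc zero))       (suc zero)             = refl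
Qconc-swapHalves n (suc (suc zero))       (suc (suc zero))       = refl
Qconc-swapHalves n (suc (suc zero))       (suc (suc (suc zero))) = refl
Qconc-swapHalves n (suc (suc (suc zero))) zero                   = refl
Qconc-swapHalves n (suc (suc (suc zero))) (suc zero)             = refl
Qconc-swapHalves n (suc (suc (suc zero))) (suc (suc zero))       = refl
Qconc-swapHalves n (suc (suc (suc zero))) (suc (suc (suc zero))) = refl

∸-eval : ∀ {a} b c → a ≡ b + c → a ∸ b ≡ c
∸-eval b c a≡b+c = trans (cong (_∸ b) a≡b+c) (m+n∸m≡n b c)

module _ (m : ℕ) where

  2*suc∸2 : 2 * suc m ∸ 2 ≡ m + m
  2*suc∸2 = ∸-eval 2 (m + m) (expand m)
    where
    expand : ∀ m → 2 * suc m ≡ 2 + (m + m)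
    expand = solve-∀

  ownHalf-arith : ∀ {d} → d + (m + m) ≡ 3 * suc m ∸ 2 → d ≡ suc m
  ownHalf-arith {d} e = +-cancelʳ-≡ (m + m) d (suc m) (trans e (∸-eval 2 (suc m + (m + m)) (expand m)))
    where
    expand : ∀ m → 3 * suc m ≡ 2 + (suc m + (m + m))
    expand = solve-∀

  crossed-arith : ∀ {c′ c} → c′ + m + m ≡ suc m + c → c′ + m ≡ c + 1
  crossed-arith {c′} {c} e = +-cancelʳ-≡ m (c′ + m) (c + 1) (trans e (shift m c))
    where
    shift : ∀ m c → suc m + c ≡ c + 1 + m
    shift = solve-∀

  sameHalf-diffClass-arith : ∀ {c′ c} → c′ + (m + m) ≡ c + 2 → c ≡ 2 * suc m ∸ 2 → c′ ≡ 2
  sameHalf-diffClass-arith {c′} {c} e c≡ = +-cancelʳ-≡ (m + m) c′ 2 (begin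
    c′ + (m + m)  ≡⟨ e ⟩
    c + 2         ≡⟨ cong (_+ 2) (trans c≡ 2*suc∸2) ⟩
    m + m + 2     ≡⟨ +-comm (m + m) 2 ⟩
    2 + (m + m)   ∎)
    where open ≡-Reasoning

  oppositeHalves-arith : ∀ {c′ c} → c′ + c ≡ suc m + suc m → c ≡ 2 * suc m ∸ 2 → c′ ≡ 2
  oppositeHalves-arith {c′} {c} e c≡ = +-cancelʳ-≡ (m + m) c′ 2 (begin
    c′ + (m + m)   ≡⟨ cong (c′ +_) (trans c≡ 2*suc∸2) ⟨
    c′ + c         ≡⟨ e ⟩
    suc m + suc m  ≡⟨ regroup m ⟩
    2 + (m + m)    ∎)
    where
    open ≡-Reasoning
    regroup : ∀ m → suc m + suc m ≡ 2 + (m + m)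
    regroup = solve-∀

sameClass-arith : ∀ m {c′ c} → 1 ≤ m →
  c′ + (m + m) ≡ c + 2 → c ≡ 3 * suc m ∸ 6 → c′ ≡ suc m ∸ 2
sameClass-arith (suc k) {c′} {c} (s≤s z≤n) e c≡ = +-cancelʳ-≡ (suc k + suc k) c′ k (begin
  c′ + (suc k + suc k)       ≡⟨ e ⟩
  c + 2                      ≡⟨ cong (_+ 2) (trans c≡ (∸-eval 6 (k + k + k) (expand k))) ⟩
  k + k + k + 2              ≡⟨ regroup k ⟩
  k + (suc k + suc k)        ∎)
  where
  open ≡-Reasoning
  expand : ∀ k → 3 * suc (suc k) ≡ 6 + (k + k + k)
  expand = solve-∀
  regroup : ∀ k → k + k + k + 2 ≡ k + (suc k + suc k)
  regroup = solve-∀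

distinct⇒1≤ : ∀ {m} {a b : Fin (suc m)} → ¬ a ≡ b → 1 ≤ m
distinct⇒1≤ {zero}  {zero} {zero} a≢b = contradiction refl a≢b
distinct⇒1≤ {suc m} _ = s≤s z≤n

module Switching (m : ℕ) (A : Vtx 4 (suc m) → Vtx 4 (suc m) → Bool)
  (regular : ∀ x → deg A x ≡ 3 * suc m ∸ 2) (Q : HasQuotient A (Qhyp (suc m))) where

  open ≡-Reasoning

  degIn-across : ∀ x j → crosses x j ≡ true → degIn A x j ≡ m
  degIn-across (i , a) j i↔j = trans (Q i j a) (Qhyp-across (suc m) i j i↔j)

  degIn-switch-≡ : ∀ x j → degIn (switch A) x j ≡ (if crosses x j then 1 else degIn A x j)
  degIn-switch-≡ x j = byCrossing (crosses x j) refl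
    where
    byCrossing : ∀ b → crosses x j ≡ b → degIn (switch A) x j ≡ (if b then 1 else degIn A x j)
    byCrossing true  x↔j = +-cancelʳ-≡ m _ 1
      (trans (cong (degIn (switch A) x j +_) (sym (degIn-across x j x↔j)))
             (degIn-switch-crossed A x j x↔j))
    byCrossing false x↔j = degIn-switch-uncrossed A x j x↔j

  degInOwnHalf-≡ : ∀ x → degInOwnHalf A x ≡ suc m
  degInOwnHalf-≡ x = ownHalf-arith m (begin
    degInOwnHalf A x + (m + m)
      ≡⟨ cong (degInOwnHalf A x +_) (classSum-crossing (side (cls x)) m) ⟨
    degInOwnHalf A x + classSum (λ j → if crosses x j then m else 0)
      ≡⟨ classSum-+-cong split ⟩
    classSum (degIn A x)  ≡⟨ deg-classSum A x ⟨
    deg A x               ≡⟨ regular x ⟩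
    3 * suc m ∸ 2         ∎)
    where
    split : ∀ j → (if crosses x j then 0 else degIn A x j) + (if crosses x j then m else 0) ≡ degIn A x j
    split j with crosses x j in x↔j
    ... | true  = sym (degIn-across x j x↔j)
    ... | false = +-identityʳ _

  deg-switch : ∀ x → deg (switch A) x ≡ suc m + 2
  deg-switch x = begin
    deg (switch A) x                 ≡⟨ deg-classSum (switch A) x ⟩
    classSum (degIn (switch A) x)    ≡⟨ classSum-+-cong split ⟨
    degInOwnHalf A x + classSum (λ j → if crosses x j then 1 else 0)
      ≡⟨ cong₂ _+_ (degInOwnHalf-≡ x) (classSum-crossing (side (cls x)) 1) ⟩
    suc m + 2                        ∎
    where
    split : ∀ j → (if crosses x j then 0 else degIn A x j) + (if crosses x j then 1 else 0)
                    ≡ degIn (switch A) x j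
    split j rewrite degIn-switch-≡ x j with crosses x j
    ... | true  = refl
    ... | false = +-identityʳ _

  switch-hasQuotient : HasQuotient (switch A) (λ i j → Qconc (suc m) (swapHalves i) (swapHalves j))
  switch-hasQuotient i j a = begin
    degIn (switch A) (i , a) j                           ≡⟨ degIn-switch-≡ (i , a) j ⟩
    (if side i xor side j then 1 else degIn A (i , a) j) ≡⟨ cong (if side i xor side j then 1 else_) (Q i j a) ⟩
    (if side i xor side j then 1 else Qhyp (suc m) i j)  ≡⟨ Qconc-swapHalves (suc m) i j ⟨
    Qconc (suc m) (swapHalves i) (swapHalves j)          ∎

  common-switch-sameHalf : ∀ x y → side (cls x) ≡ side (cls y) →
    common (switch A) x y + (m + m) ≡ common A x y + 2
  common-switch-sameHalf x y same = begin
    common (switch A) x y + (m + m)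
      ≡⟨ cong₂ _+_ (common-classSum (switch A) x y) (sym (classSum-crossing (side (cls x)) m)) ⟩
    classSum (commonIn (switch A) x y) + classSum (λ j → if crosses x j then m else 0)
      ≡⟨ classSum-+-cong perClass ⟩
    classSum (λ j → commonIn A x y j + (if crosses x j then 1 else 0))
      ≡⟨ classSum-+ (commonIn A x y) _ ⟩
    classSum (commonIn A x y) + classSum (λ j → if crosses x j then 1 else 0)
      ≡⟨ cong₂ _+_ (sym (common-classSum A x y)) (classSum-crossing (side (cls x)) 1) ⟩
    common A x y + 2 ∎
    where
    perClass : ∀ j → commonIn (switch A) x y j + (if crosses x j then m else 0)
                       ≡ commonIn A x y j + (if crosses x j then 1 else 0)
    perClass j = byCrossing (crosses x j) refl (cong (_xor side j) (sym same))
      where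
      byCrossing : ∀ b → crosses x j ≡ b → crosses y j ≡ b →
        commonIn (switch A) x y j + (if b then m else 0) ≡ commonIn A x y j + (if b then 1 else 0)
      byCrossing true  x↔j y↔j = crossed-arith m (begin
        commonIn (switch A) x y j + m + m
          ≡⟨ cong₂ (λ d d′ → commonIn (switch A) x y j + d + d′)
                   (degIn-across x j x↔j) (degIn-across y j y↔j) ⟨
        commonIn (switch A) x y j + degIn A x j + degIn A y j
          ≡⟨ commonIn-switch-both A x y j x↔j y↔j ⟩
        suc m + commonIn A x y j ∎)
      byCrossing false x↔j y↔j = cong (_+ 0) (commonIn-switch-neither A x y j x↔j y↔j)

  common-switch-oppositeHalves : ∀ x y → side (cls y) ≡ not (side (cls x)) →
    common (switch A) x y + common A x y ≡ suc m + suc m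
  common-switch-oppositeHalves x y opposite = begin
    common (switch A) x y + common A x y
      ≡⟨ cong₂ _+_ (common-classSum (switch A) x y) (common-classSum A x y) ⟩
    classSum (commonIn (switch A) x y) + classSum (commonIn A x y)
      ≡⟨ classSum-+-cong perClass ⟩
    classSum (λ j → (if crosses y j then 0 else degIn A y j) + (if crosses x j then 0 else degIn A x j))
      ≡⟨ classSum-+ _ _ ⟩
    degInOwnHalf A y + degInOwnHalf A x
      ≡⟨ cong₂ _+_ (degInOwnHalf-≡ y) (degInOwnHalf-≡ x) ⟩
    suc m + suc m ∎
    where
    y↔j≡not-x↔j : ∀ j → crosses y j ≡ not (crosses x j)
    y↔j≡not-x↔j j = trans (cong (_xor side j) opposite) (sym (not-distribˡ-xor (side (cls x)) (side j)))

    perClass : ∀ j → commonIn (switch A) x y j + commonIn A x y j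
                       ≡ (if crosses y j then 0 else degIn A y j) + (if crosses x j then 0 else degIn A x j)
    perClass j = byCrossing (crosses x j) (crosses y j) refl refl
      where
      byCrossing : ∀ b b′ → crosses x j ≡ b → crosses y j ≡ b′ →
        commonIn (switch A) x y j + commonIn A x y j
          ≡ (if b′ then 0 else degIn A y j) + (if b then 0 else degIn A x j)
      byCrossing true  false x↔j y↔j = trans (commonIn-switch-first A x y j x↔j y↔j) (sym (+-identityʳ _))
      byCrossing false true  x↔j y↔j = commonIn-switch-second A x y j x↔j y↔j
      byCrossing true  true  x↔j y↔j = ⊥-elim (not-¬ (trans y↔j (sym x↔j)) (y↔j≡not-x↔j j))
      byCrossing false false x↔j y↔j = ⊥-elim (not-¬ (trans y↔j (sym x↔j)) (y↔j≡not-x↔j j))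

lemma9 : (n : ℕ) → n ≥ 1 → (A : Vtx 4 n → Vtx 4 n → Bool) →
    IsDDG 4 n (3 * n ∸ 2) (3 * n ∸ 6) (2 * n ∸ 2) A →
    HasQuotient A (Qhyp n) →
    IsDDG 4 n (n + 2) (n ∸ 2) 2 (switch A)
      × Σ (Permutation′ 4) (λ σ →
          HasQuotient (switch A) (λ i j → Qconc n (σ ⟨$⟩ʳ i) (σ ⟨$⟩ʳ j)))
lemma9 (suc m) (s≤s z≤n) A G Q = switchedDDG , swapHalvesᵖ , switch-hasQuotient
  where
  open IsDDG G
  open Switching m A regular Q

  switch-sameCls : ∀ x y → ¬ x ≡ y → cls x ≡ cls y → common (switch A) x y ≡ suc m ∸ 2
  switch-sameCls (i , a) (.i , b) x≢y refl =
    sameClass-arith m (distinct⇒1≤ (x≢y ∘ cong (i ,_)))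
      (common-switch-sameHalf (i , a) (i , b) refl) (sameCls (i , a) (i , b) x≢y refl)

  switch-diffCls : ∀ x y → ¬ cls x ≡ cls y → common (switch A) x y ≡ 2
  switch-diffCls x y i≢j with side (cls x) ≟ᵇ side (cls y)
  ... | yes same = sameHalf-diffClass-arith m (common-switch-sameHalf x y same) (diffCls x y i≢j)
  ... | no  opp  =
    oppositeHalves-arith m (common-switch-oppositeHalves x y (¬-not (opp ∘ sym))) (diffCls x y i≢j)

  switchedDDG : IsDDG 4 (suc m) (suc m + 2) (suc m ∸ 2) 2 (switch A)
  switchedDDG = record
    { simple  = switch-isSimpleGraph A simple
    ; regular = deg-switch
    ; sameCls = switch-sameCls
    ; diffCls = switch-diffCls
    }
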